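{- Let $G$ be a simple graph and let $S$ be a subset of the vertices of $G$ such that $G\setminus S$ is connected and every vertex of $S$ has a neighbour in $G\setminus S$. Let $G'$ be the graph obtained from $G$ by adding an edge between every pair of vertices of $S$ (that are not already adjacent). Then there is a constant $c$ (depending on $G$ and $S$) such that for every integer $k>c$, $\mathrm{Fan}(G',S,k-c)$ is a minor of $\mathrm{Fan}(G,S,k)$.
   Context: For a graph $G$, a proper subset $S$ of its vertices and a positive integer $k$, $\mathrm{Fan}(G,S,k)$ is the simple graph formed as the union of $k$ copies of $G$ which all share the same copies of the vertices of $S$ (and of the edges among them) and have pairwise distinct copies of the vertices of $V(G)\setminus S$. A minor of a graph $H$ is a simple graph obtained from $H$ by a sequence of edge contractions (merging resulting parallel edges and deleting resulting loops), edge deletions and vertex deletions. -}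

module Defs where

open import Data.Nat using (ℕ)
open import Data.Fin using (Fin)
open import Data.Fin.Subset using (Subset; _∈_; _∉_)
open import Data.Product using (Σ; ∃; _×_; _,_; proj₁; proj₂)
open import Data.Sum using (_⊎_; inj₁; inj₂)
open import Data.Empty using (⊥; ⊥-elim)
open import Relation.Nullary using (¬_)
open import Relation.Binary.PropositionalEquality using (_≡_; refl; sym)

record Graph (V : Set) : Set₁ where
  field
    Adj    : V → V → Set
    symm   : ∀ {u v} → Adj u v → Adj v u
    irrefl : ∀ {v} → ¬ Adj v v
open Graph public

data Walk {V : Set} (G : Graph V) (P : V → Set) : V → V → Set where
  here : ∀ {u} → P u → Walk G P u u
  step : ∀ {u v w} → P u → Adj G u v → Walk G P v w → Walk G P u w

InducedConnected : {V : Set} → Graph V → (V → Set) → Set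
InducedConnected G P = (∃ λ v → P v) × (∀ u v → P u → P v → Walk G P u v)

record MinorModel {W V : Set} (H : Graph W) (G : Graph V) : Set₁ where
  field
    branch    : W → V → Set
    nonempty  : ∀ w → ∃ λ v → branch w v
    disjoint  : ∀ w w' v → branch w v → branch w' v → w ≡ w'
    connected : ∀ w u v → branch w u → branch w v → Walk G (branch w) u v
    edges     : ∀ w w' → Adj H w w' →
                ∃ λ u → ∃ λ v → branch w u × branch w' v × Adj G u v

IsMinor : {W V : Set} → Graph W → Graph V → Set₁
IsMinor H G = MinorModel H G

-- Fan(G, S, k): k copies of G glued along S.

data FanV (n : ℕ) (S : Subset n) (k : ℕ) : Set where
  shared : (v : Fin n) → v ∈ S → FanV n S k
  copy   : (i : Fin k) (v : Fin n) → v ∉ S → FanV n S k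

module _ {n : ℕ} {S : Subset n} {k : ℕ} where

  vert : FanV n S k → Fin n
  vert (shared v _) = v
  vert (copy _ v _) = v

  sameCopy : FanV n S k → FanV n S k → Set
  sameCopy (copy i _ _) (copy j _ _) = i ≡ j
  sameCopy _ _ = Data.Unit.⊤ where import Data.Unit

  sameCopy-sym : ∀ x y → sameCopy x y → sameCopy y x
  sameCopy-sym (shared _ _) (shared _ _) p = p
  sameCopy-sym (shared _ _) (copy _ _ _) p = p
  sameCopy-sym (copy _ _ _) (shared _ _) p = p
  sameCopy-sym (copy _ _ _) (copy _ _ _) p = sym p

Fan : {n : ℕ} → Graph (Fin n) → (S : Subset n) → (k : ℕ) → Graph (FanV n S k)
Fan {n} G S k = record
  { Adj    = λ x y → sameCopy x y × Adj G (vert x) (vert y)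
  ; symm   = λ {x} {y} p → sameCopy-sym x y (proj₁ p) , symm G (proj₂ p)
  ; irrefl = λ p → irrefl G (proj₂ p)
  }

completeOn : {n : ℕ} → Graph (Fin n) → Subset n → Graph (Fin n)
completeOn G S = record
  { Adj    = λ u v → Adj G u v ⊎ (u ∈ S × v ∈ S × ¬ u ≡ v)
  ; symm   = λ { (inj₁ a) → inj₁ (symm G a)
               ; (inj₂ (a , b , c)) → inj₂ (b , a , λ e → c (sym e)) }
  ; irrefl = λ { (inj₁ a) → irrefl G a ; (inj₂ (_ , _ , c)) → c refl }
  }

{-# OPTIONS --safe #-}
module Submission where

-- Sacrifice n of the k copies of G, one for each vertex s of G: the copy
-- indexed by s ∈ S, glued to the shared vertex s, forms a connected branch set
-- (G ∖ S is connected and s has a neighbour in it), and the shared vertex t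
-- has a neighbour in that copy, which realises the new edge st of G'. The
-- remaining k ∸ n copies are mapped onto themselves.

open import Defs
open import Data.Nat using (ℕ; _<_; _∸_; _+_)
open import Data.Nat.Properties using (m+[n∸m]≡n; <⇒≤)
open import Data.Fin using (Fin; splitAt; _↑ˡ_; _↑ʳ_)
open import Data.Fin.Properties using (splitAt-↑ˡ; splitAt-↑ʳ; ↑ʳ-injective)
open import Data.Fin.Subset using (Subset; _∈_; _∉_)
open import Data.Vec.Properties.WithK using ([]=-irrelevant)
open import Data.Product using (∃; _×_; _,_)
open import Data.Sum using (inj₁; inj₂)
open import Data.Sum.Properties using (inj₁-injective)
open import Data.Unit using (tt)
open import Data.Empty using (⊥; ⊥-elim)
open import Relation.Binary.PropositionalEquality using (_≡_; refl; sym; trans; cong; subst)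

module _ {V : Set} {G : Graph V} {P : V → Set} where

  Walk-head : ∀ {u v} → Walk G P u v → P u
  Walk-head (here p)     = p
  Walk-head (step p _ _) = p

  _++ᵂ_ : ∀ {u v w} → Walk G P u v → Walk G P v w → Walk G P u w
  here _        ++ᵂ q = q
  step pu u~v r ++ᵂ q = step pu u~v (r ++ᵂ q)

  Walk-reverse : ∀ {u v} → Walk G P u v → Walk G P v u
  Walk-reverse (here p)        = here p
  Walk-reverse (step pu u~v r) = Walk-reverse r ++ᵂ step (Walk-head r) (symm G u~v) (here pu)

  Walk-via : ∀ {c} → (∀ x → P x → Walk G P x c) → ∀ u v → P u → P v → Walk G P u v
  Walk-via toCentre u v pu pv = toCentre u pu ++ᵂ Walk-reverse (toCentre v pv)

module _ {n : ℕ} {G : Graph (Fin n)} {S : Subset n} {k : ℕ} where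

  copy-walk-to-shared : (Q : FanV n S k → Set) (j : Fin k) {s : Fin n} (s∈S : s ∈ S) →
    Q (shared s s∈S) → (∀ v v∉S → Q (copy j v v∉S)) →
    ∀ {a b} (a∉S : a ∉ S) → Walk G (_∉ S) a b → Adj G b s →
    Walk (Fan G S k) Q (copy j a a∉S) (shared s s∈S)
  copy-walk-to-shared Q j s∈S Qs Qj a∉S (here _) b~s =
    step (Qj _ a∉S) (tt , b~s) (here Qs)
  copy-walk-to-shared Q j s∈S Qs Qj a∉S (step _ a~v rest) b~s =
    step (Qj _ a∉S) (refl , a~v) (copy-walk-to-shared Q j s∈S Qs Qj (Walk-head rest) rest b~s)

module FanMinor {n : ℕ} (G : Graph (Fin n)) (S : Subset n)
  (connected : ∀ u v → u ∉ S → v ∉ S → Walk G (_∉ S) u v)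
  (neighbour : ∀ s → s ∈ S → ∃ λ v → v ∉ S × Adj G s v)
  (m : ℕ) where

  H : Graph (FanV n S m)
  H = Fan (completeOn G S) S m

  F : Graph (FanV n S (n + m))
  F = Fan G S (n + m)

  -- The copies of F are indexed by Fin (n + m): the first n are hubs, the
  -- copy n ↑ʳ i of F carries the copy i of H.
  branch : FanV n S m → FanV n S (n + m) → Set
  branch (shared s s∈S) (shared t t∈S) = shared {k = n + m} t t∈S ≡ shared s s∈S
  branch (shared s _)   (copy j _ _)   = splitAt n j ≡ inj₁ s
  branch (copy i v v∉S) x              = x ≡ copy (n ↑ʳ i) v v∉S

  hub-is-not-carrier : ∀ {s} i → splitAt n (n ↑ʳ i) ≡ inj₁ s → ⊥
  hub-is-not-carrier i e with trans (sym (splitAt-↑ʳ n m i)) e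
  ... | ()

  copy-injective : ∀ {j j' v v' p p'} → copy {n} {S} {n + m} j v p ≡ copy j' v' p' → j ≡ j'
  copy-injective refl = refl

  nonempty : ∀ w → ∃ λ x → branch w x
  nonempty (shared s s∈S) = shared s s∈S , refl
  nonempty (copy i v v∉S) = copy (n ↑ʳ i) v v∉S , refl

  disjoint : ∀ w w' x → branch w x → branch w' x → w ≡ w'
  disjoint (shared _ _) (shared _ _) (shared _ _) e e' with trans (sym e) e'
  ... | refl = refl
  disjoint (shared s p) (shared s' p') (copy _ _ _) e e' with inj₁-injective (trans (sym e) e')
  ... | refl = cong (shared s) ([]=-irrelevant p p')
  disjoint (shared _ _) (copy _ _ _) (shared _ _) _ ()
  disjoint (shared _ _) (copy i _ _) (copy _ _ _) e refl = ⊥-elim (hub-is-not-carrier i e)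
  disjoint (copy _ _ _) (shared _ _) (shared _ _) () _
  disjoint (copy i _ _) (shared _ _) (copy _ _ _) refl e = ⊥-elim (hub-is-not-carrier i e)
  disjoint (copy i v p) (copy i' v' p') _ refl e' with ↑ʳ-injective n i i' (copy-injective e')
  disjoint (copy i v p) (copy .i .v .p) _ refl refl | refl = refl

  hub-reaches-centre : ∀ s (s∈S : s ∈ S) x → branch (shared s s∈S) x →
    Walk F (branch (shared s s∈S)) x (shared s s∈S)
  hub-reaches-centre s s∈S (shared _ _) refl = here refl
  hub-reaches-centre s s∈S (copy j a a∉S) e with neighbour s s∈S
  ... | w , w∉S , s~w =
    copy-walk-to-shared (branch (shared s s∈S)) j s∈S refl (λ _ _ → e)
      a∉S (connected a w a∉S w∉S) (symm G s~w)

  branch-connected : ∀ w x y → branch w x → branch w y → Walk F (branch w) x y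
  branch-connected (shared s s∈S) = Walk-via (hub-reaches-centre s s∈S)
  branch-connected (copy _ _ _) _ _ refl refl = here refl

  edges : ∀ w w' → Adj H w w' → ∃ λ x → ∃ λ y → branch w x × branch w' y × Adj F x y
  edges (shared s p) (shared t q) (_ , inj₁ s~t) = shared s p , shared t q , refl , refl , tt , s~t
  edges (shared s p) (shared t q) (_ , inj₂ _) with neighbour t q
  ... | v , v∉S , t~v = copy (s ↑ˡ m) v v∉S , shared t q , splitAt-↑ˡ n s m , refl , tt , symm G t~v
  edges (shared s p) (copy i v q) (_ , inj₁ s~v) = shared s p , copy (n ↑ʳ i) v q , refl , refl , tt , s~v
  edges (shared _ _) (copy _ _ v∉S) (_ , inj₂ (_ , v∈S , _)) = ⊥-elim (v∉S v∈S)
  edges (copy i v q) (shared s p) (_ , inj₁ v~s) = copy (n ↑ʳ i) v q , shared s p , refl , refl , tt , v~s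
  edges (copy _ _ v∉S) (shared _ _) (_ , inj₂ (v∈S , _)) = ⊥-elim (v∉S v∈S)
  edges (copy i u q) (copy .i v r) (refl , inj₁ u~v) =
    copy (n ↑ʳ i) u q , copy (n ↑ʳ i) v r , refl , refl , refl , u~v
  edges (copy _ _ u∉S) (copy _ _ _) (refl , inj₂ (u∈S , _)) = ⊥-elim (u∉S u∈S)

  fan-minor : IsMinor H F
  fan-minor = record
    { branch    = branch
    ; nonempty  = nonempty
    ; disjoint  = disjoint
    ; connected = branch-connected
    ; edges     = edges
    }

lemma4 : (n : ℕ) (G : Graph (Fin n)) (S : Subset n) →
    (∃ λ v → v ∉ S) →
    InducedConnected G (λ v → v ∉ S) →
    (∀ s → s ∈ S → ∃ λ v → v ∉ S × Adj G s v) →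
    ∃ λ (c : ℕ) → ∀ (k : ℕ) → c < k →
    IsMinor (Fan (completeOn G S) S (k ∸ c)) (Fan G S k)
lemma4 n G S _ (_ , connected) neighbour = n , λ k n<k →
  subst (λ k' → IsMinor (Fan (completeOn G S) S (k ∸ n)) (Fan G S k'))
        (m+[n∸m]≡n (<⇒≤ n<k))
        (FanMinor.fan-minor G S connected neighbour (k ∸ n))
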